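{- Let $\Gamma$ be a connected graph, $X\le\mathrm{Aut}(\Gamma)$, with $\Gamma$ $(X,2)$-distance transitive, and let $N\trianglelefteq X$ be such that $\Gamma$ is an $N$-cover of $\Gamma_N$. Suppose $K\trianglelefteq X$ and $K\le N$. Then $\Gamma$ is a $K$-cover of $\Gamma_K$ and $\Gamma_K$ is an $N/K$-cover of $\Gamma_N$ (identifying $\Gamma_N$ with the quotient $(\Gamma_K)_{N/K}$). Moreover, $\Gamma_K$ is $(X/K,2)$-distance transitive and $\Gamma_N$ is $(X/N,2)$-distance transitive.
   Context: $\Gamma$ is $(X,2)$-distance transitive if $X$ is transitive on $V(\Gamma)$ and for every vertex $u$, $X_u$ is transitive on the vertices at distance $1$ and on those at distance $2$ from $u$. For $N\trianglelefteq X$, the quotient graph $\Gamma_N$ has as vertices the $N$-orbits on $V(\Gamma)$, two distinct orbits adjacent iff some edge of $\Gamma$ joins them; $X/N$ acts naturally on $V(\Gamma_N)$. $\Gamma$ is an $N$-cover of $\Gamma_N$ if every vertex $u$ has the same valency in $\Gamma$ as $u^N$ in $\Gamma_N$. -}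

module Defs where

open import Data.Nat using (ℕ)
open import Data.Fin using (Fin)
open import Data.Product using (Σ; ∃; _×_; _,_; proj₁; proj₂)
open import Relation.Nullary using (¬_; Dec)
open import Relation.Binary using (Setoid; IsEquivalence)
open import Relation.Binary.PropositionalEquality
  using (_≡_; refl; sym; trans; cong; isEquivalence)
open import Function.Bundles using (Bijection)

record Graph : Set₁ where
  field
    n      : ℕ
    _~_    : Fin n → Fin n → Set
    ~-dec  : ∀ u v → Dec (u ~ v)
    ~-sym  : ∀ {u v} → u ~ v → v ~ u
    ~-irr  : ∀ {u} → ¬ (u ~ u)

  V : Set
  V = Fin n

-- Automorphisms of Γ (bijections of V preserving and reflecting adjacency).
-- Automorphisms act on the right:  u ^ x = fun x u.

module _ (Γ : Graph) where
  open Graph Γ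

  record Aut : Set where
    field
      fun      : V → V
      inv      : V → V
      fun-inv  : ∀ v → fun (inv v) ≡ v
      inv-fun  : ∀ v → inv (fun v) ≡ v
      pres     : ∀ {u v} → u ~ v → fun u ~ fun v
      refl~    : ∀ {u v} → fun u ~ fun v → u ~ v
  open Aut public

module _ {Γ : Graph} where
  open Graph Γ

  idA : Aut Γ
  idA = record { fun = λ v → v ; inv = λ v → v ; fun-inv = λ _ → refl
               ; inv-fun = λ _ → refl ; pres = λ p → p ; refl~ = λ p → p }

  _∙A_ : Aut Γ → Aut Γ → Aut Γ
  x ∙A y = record
    { fun = λ v → fun y (fun x v)
    ; inv = λ v → inv x (inv y v)
    ; fun-inv = λ v → trans (cong (fun y) (fun-inv x (inv y v))) (fun-inv y v)
    ; inv-fun = λ v → trans (cong (inv x) (inv-fun y (fun x v))) (inv-fun x v)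
    ; pres = λ p → pres y (pres x p)
    ; refl~ = λ p → refl~ x (refl~ y p) }

  _⁻¹A : Aut Γ → Aut Γ
  x ⁻¹A = record
    { fun = inv x ; inv = fun x ; fun-inv = inv-fun x ; inv-fun = fun-inv x
    ; pres = λ {u} {v} p → refl~ x (subst2 p (sym (fun-inv x u)) (sym (fun-inv x v)))
    ; refl~ = λ {u} {v} p → subst2 (pres x p) (fun-inv x u) (fun-inv x v) }
    where
    subst2 : ∀ {a b c d} → a ~ b → a ≡ c → b ≡ d → c ~ d
    subst2 p refl refl = p

  _≗A_ : Aut Γ → Aut Γ → Set
  x ≗A y = ∀ v → fun x v ≡ fun y v

record Subgroup (Γ : Graph) : Set₁ where
  field
    mem     : Aut Γ → Set
    mem-dec : ∀ x → Dec (mem x)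
    mem-≗   : ∀ {x y} → x ≗A y → mem x → mem y
    id∈     : mem idA
    ∙∈      : ∀ {x y} → mem x → mem y → mem (x ∙A y)
    ⁻¹∈     : ∀ {x} → mem x → mem (x ⁻¹A)
open Subgroup public

module _ {Γ : Graph} where

  _⊆S_ : Subgroup Γ → Subgroup Γ → Set
  H ⊆S G = ∀ x → mem H x → mem G x

  record IsNormal (N X : Subgroup Γ) : Set where
    field
      sub  : N ⊆S X
      conj : ∀ x m → mem X x → mem N m → mem N ((x ⁻¹A) ∙A (m ∙A x))

-- Graphs whose vertex set carries an equivalence ("setoid graphs");
-- used to represent quotient graphs, whose vertices are orbits
-- (represented by their elements, with equality = lying in the same orbit).

record SGraph : Set₁ where
  field
    Vt     : Set
    _≈_    : Vt → Vt → Set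
    ≈-eq   : IsEquivalence _≈_
    _~_    : Vt → Vt → Set

  Dist2 : Vt → Vt → Set
  Dist2 u v = ¬ (u ≈ v) × ¬ (u ~ v) × Σ Vt (λ w → (u ~ w) × (w ~ v))

  Nbhd : Vt → Setoid _ _
  Nbhd u = record
    { Carrier = Σ Vt (λ v → u ~ v)
    ; _≈_ = λ a b → proj₁ a ≈ proj₁ b
    ; isEquivalence = record
      { refl = IsEquivalence.refl ≈-eq
      ; sym = IsEquivalence.sym ≈-eq
      ; trans = IsEquivalence.trans ≈-eq } }

toS : Graph → SGraph
toS Γ = record { Vt = Graph.V Γ ; _≈_ = _≡_ ; ≈-eq = isEquivalence ; _~_ = Graph._~_ Γ }

module _ {Γ : Graph} where
  open Graph Γ

  Orb : Subgroup Γ → V → V → Set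
  Orb N u v = Σ (Aut Γ) (λ m → mem N m × fun m u ≡ v)

  Orb-eq : (N : Subgroup Γ) → IsEquivalence (Orb N)
  Orb-eq N = record
    { refl = idA , id∈ N , refl
    ; sym = λ { (m , m∈ , refl) → (m ⁻¹A) , ⁻¹∈ N m∈ , inv-fun m _ }
    ; trans = λ { (m , m∈ , refl) (k , k∈ , refl) → (m ∙A k) , ∙∈ N m∈ k∈ , refl } }

_/_ : (Γ : Graph) → Subgroup Γ → SGraph
Γ / N = record
  { Vt = Graph.V Γ
  ; _≈_ = Orb N
  ; ≈-eq = Orb-eq N
  ; _~_ = λ u v → ¬ (Orb N u v) ×
                  Σ (Graph.V Γ) (λ u' → Σ (Graph.V Γ) (λ v' →
                     Orb N u u' × Orb N v v' × Graph._~_ Γ u' v')) }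

module _ (Γ : Graph) where
  open Graph Γ

  data Walk : V → V → Set where
    here : ∀ {u} → Walk u u
    step : ∀ {u v w} → u ~ v → Walk v w → Walk u w

  Connected : Set
  Connected = ∀ u v → Walk u v

-- For the quotient Γ_K and the group X/K, an element xK acts on the
-- orbit u^K as (u^x)^K; we represent xK by its representative x ∈ X.

record DistTrans2 (Δ : SGraph) {A : Set} (act : A → SGraph.Vt Δ → SGraph.Vt Δ) : Set where
  open SGraph Δ
  field
    vtrans : ∀ u v → Σ A (λ a → act a u ≈ v)
    dist1  : ∀ u v w → u ~ v → u ~ w →
             Σ A (λ a → (act a u ≈ u) × (act a v ≈ w))
    dist2  : ∀ u v w → Dist2 u v → Dist2 u w →
             Σ A (λ a → (act a u ≈ u) × (act a v ≈ w))

Elts : {Γ : Graph} → Subgroup Γ → Set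
Elts {Γ} X = Σ (Aut Γ) (mem X)

actX : {Γ : Graph} (X : Subgroup Γ) → Elts X → Graph.V Γ → Graph.V Γ
actX X x v = fun (proj₁ x) v

-- Γ is an N-cover of Γ_N: each vertex u has the same valency in Γ as u^N
-- in Γ_N (equal cardinality = existence of a bijection).

IsCover : (Γ : Graph) → Subgroup Γ → Set
IsCover Γ N = ∀ u → Bijection (SGraph.Nbhd (toS Γ) u) (SGraph.Nbhd (Γ / N) u)

-- Γ_K is an N/K-cover of Γ_N (= (Γ_K)_{N/K}): u^K has the same valency in
-- Γ_K as u^N in Γ_N.
IsQuotCover : (Γ : Graph) → Subgroup Γ → Subgroup Γ → Set
IsQuotCover Γ K N = ∀ u → Bijection (SGraph.Nbhd (Γ / K) u) (SGraph.Nbhd (Γ / N) u)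

-- An edge of Γ_H joins two orbits u^H, v^H, so after moving it by an element
-- of H it starts at u: every edge, and hence every 2-geodesic, of Γ_H lifts to
-- Γ with a prescribed initial vertex. As X normalises H it permutes H-orbits,
-- so the (X,2)-distance transitivity of Γ descends to every normal quotient.
-- Since Γ is finite, Γ is an H-cover of Γ_H exactly when the projection onto
-- H-orbits is injective on each closed neighbourhood {u} ∪ Γ(u): the cover
-- bijection yields a self-map of Γ(u) that is injective modulo H, hence onto.
-- Injectivity on closed neighbourhoods passes from N to the smaller group K,
-- and it makes both Γ → Γ_K and Γ_K → Γ_N bijective on neighbourhoods.
module Submission where

open import Data.Nat using (suc)
open import Data.Nat.Properties using (n<1+n)
open import Data.Fin using (Fin; punchOut; _≟_)
open import Data.Fin.Properties using (any?; punchOut-injective; <⇒notInjective)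
open import Data.Product using (Σ; ∃; _×_; _,_; proj₁; proj₂)
open import Data.Empty using (⊥-elim)
open import Function using (_∘_)
open import Function.Bundles using (Bijection)
open import Relation.Nullary using (¬_; Dec; yes; no)
open import Relation.Binary using (Rel; Reflexive; IsEquivalence)
open import Relation.Unary using (Pred; Decidable)
open import Relation.Binary.PropositionalEquality
open import Defs

injective⇒surjective : ∀ {n} (f : Fin n → Fin n) →
  (∀ {a b} → f a ≡ f b → a ≡ b) → ∀ w → ∃ λ a → f a ≡ w
injective⇒surjective {suc m} f f-inj w with any? (λ a → f a ≟ w)
... | yes hit = hit
... | no miss = ⊥-elim (<⇒notInjective (n<1+n m) f∖w-injective)
  where
  f∖w : Fin (suc m) → Fin m
  f∖w a = punchOut {i = w} (λ e → miss (a , sym e))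
  f∖w-injective : ∀ {a b} → f∖w a ≡ f∖w b → a ≡ b
  f∖w-injective {a} {b} =
    f-inj ∘ punchOut-injective (λ e → miss (a , sym e)) (λ e → miss (b , sym e))

module SelfMapOfFiniteSubset
  {n ℓ ℓ′} {R : Rel (Fin n) ℓ} (R-refl : Reflexive R)
  {S : Pred (Fin n) ℓ′} (S? : Decidable S)
  (f : ∀ v → S v → Fin n) (f-S : ∀ {v} p → S (f v p))
  (f-inj : ∀ {a b} p q → R (f a p) (f b q) → a ≡ b)
  where

  -- As f may depend on the proof of S v, everything goes through its extension
  -- h by the identity off S, an injective and hence surjective map on Fin n.
  private
    extend : ∀ v → Dec (S v) → Fin n
    extend v (yes p) = f v p
    extend v (no _)  = v

    extend-injective : ∀ {a b} (da : Dec (S a)) (db : Dec (S b)) →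
                       extend a da ≡ extend b db → a ≡ b
    extend-injective (yes p) (yes q) e    = f-inj p q (subst (R _) e R-refl)
    extend-injective (yes p) (no ¬q) refl = ⊥-elim (¬q (f-S p))
    extend-injective (no ¬p) (yes q) refl = ⊥-elim (¬p (f-S q))
    extend-injective (no _)  (no _)  e    = e

    extend-preimage : ∀ {a w} (da : Dec (S a)) → extend a da ≡ w → S w →
                      Σ (S a) λ p → extend a da ≡ f a p
    extend-preimage (yes p) _    _ = p , refl
    extend-preimage (no ¬p) refl s = ⊥-elim (¬p s)

    h : Fin n → Fin n
    h v = extend v (S? v)

    preimage : ∀ {w} → S w → ∃ λ a → Σ (S a) λ p → h a ≡ w × h a ≡ f a p
    preimage {w} s =
      let a , ha≡w = injective⇒surjective h (extend-injective (S? _) (S? _)) w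
          p , ha≡fap = extend-preimage (S? a) ha≡w s
      in a , p , ha≡w , ha≡fap

  surjective : ∀ {w} → S w → ∃ λ a → Σ (S a) λ p → f a p ≡ w
  surjective s = let a , p , ha≡w , ha≡fap = preimage s in a , p , trans (sym ha≡fap) ha≡w

  R⇒≡ : ∀ {w₁ w₂} → S w₁ → S w₂ → R w₁ w₂ → w₁ ≡ w₂
  R⇒≡ s₁ s₂ r =
    let a₁ , p₁ , e₁ , e₁′ = preimage s₁
        a₂ , p₂ , e₂ , e₂′ = preimage s₂
        a₁≡a₂ = f-inj p₁ p₂ (subst₂ R (trans (sym e₁) e₁′) (trans (sym e₂) e₂′) r)
    in trans (sym e₁) (trans (cong h a₁≡a₂) e₂)

module _ {Γ : Graph} where
  open Graph Γ

  module Orb (H : Subgroup Γ) = IsEquivalence (Orb-eq H)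

  QAdj : Subgroup Γ → V → V → Set
  QAdj H = SGraph._~_ (Γ / H)

  Orb-⊆ : ∀ {K N : Subgroup Γ} → K ⊆S N → ∀ {a b} → Orb K a b → Orb N a b
  Orb-⊆ K⊆N (m , m∈K , e) = m , K⊆N m m∈K , e

  Orb-act : ∀ {H X : Subgroup Γ} → IsNormal H X → ∀ {x a b} → mem X x →
            Orb H a b → Orb H (fun x a) (fun x b)
  Orb-act H⊴X {x} {a} x∈X (m , m∈H , refl) =
    (x ⁻¹A) ∙A (m ∙A x) , IsNormal.conj H⊴X x m x∈X m∈H ,
    cong (fun x ∘ fun m) (inv-fun x a)

  QAdj-lift : ∀ {H : Subgroup Γ} {u v} → QAdj H u v → ∃ λ w → u ~ w × Orb H v w
  QAdj-lift {H} {u} (_ , _ , v′ , (m , m∈H , refl) , v≈v′ , e) =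
    inv m v′ ,
    refl~ m (subst (fun m u ~_) (sym (fun-inv m v′)) e) ,
    Orb.trans H v≈v′ (m ⁻¹A , ⁻¹∈ H m∈H , refl)

  Dist2-lift : ∀ {H : Subgroup Γ} {u v} → SGraph.Dist2 (Γ / H) u v →
               ∃ λ v′ → SGraph.Dist2 (toS Γ) u v′ × Orb H v v′
  Dist2-lift {H} {u} {v} (u≉v , ¬u~v , m , u~m , m≉v , a , b , m≈a , v≈b , a~b) =
    let m′ , u~m′ , m≈m′ = QAdj-lift {H} u~m
        m′~v : QAdj H m′ v
        m′~v = (λ m′≈v → m≉v (Orb.trans H m≈m′ m′≈v)) ,
               a , b , Orb.trans H (Orb.sym H m≈m′) m≈a , v≈b , a~b
        v′ , m′~v′ , v≈v′ = QAdj-lift {H} m′~v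
    in v′ ,
       ( (λ u≡v′ → u≉v (Orb.sym H (subst (Orb H v) (sym u≡v′) v≈v′)))
       , (λ u~v′ → ¬u~v (u≉v , u , v′ , Orb.refl H , v≈v′ , u~v′))
       , m′ , u~m′ , m′~v′ ) ,
       v≈v′

  stabiliser-transitivity-descends :
    ∀ {H X : Subgroup Γ} → IsNormal H X →
    {R R/ : V → V → Set} → (∀ {u v} → R/ u v → ∃ λ v′ → R u v′ × Orb H v v′) →
    (∀ u v w → R u v → R u w → Σ (Elts X) λ x → actX X x u ≡ u × actX X x v ≡ w) →
    ∀ u v w → R/ u v → R/ u w →
    Σ (Elts X) λ x → Orb H (actX X x u) u × Orb H (actX X x v) w
  stabiliser-transitivity-descends {H} H⊴X lift transitive u v w u~v u~w =
    let v′ , u~v′ , v≈v′ = lift u~v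
        w′ , u~w′ , w≈w′ = lift u~w
        x , xu≡u , xv′≡w′ = transitive u v′ w′ u~v′ u~w′
    in x , Orb.reflexive H xu≡u ,
       Orb.trans H (Orb-act H⊴X (proj₂ x) v≈v′)
                   (Orb.trans H (Orb.reflexive H xv′≡w′) (Orb.sym H w≈w′))

  /-distTrans2 : ∀ {H X : Subgroup Γ} → IsNormal H X →
                 DistTrans2 (toS Γ) (actX X) → DistTrans2 (Γ / H) (actX X)
  /-distTrans2 {H} H⊴X Γ-dt = record
    { vtrans = λ u v → let x , xu≡v = vtrans u v in x , Orb.reflexive H xu≡v
    ; dist1  = stabiliser-transitivity-descends H⊴X (QAdj-lift {H}) dist1
    ; dist2  = stabiliser-transitivity-descends H⊴X (Dist2-lift {H}) dist2
    }
    where open DistTrans2 Γ-dt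

  record InjectiveOnNeighbourhoods (H : Subgroup Γ) : Set where
    field
      neighbour-∉-orbit : ∀ {u w} → u ~ w → ¬ Orb H u w
      neighbours-≡      : ∀ {u w₁ w₂} → u ~ w₁ → u ~ w₂ → Orb H w₁ w₂ → w₁ ≡ w₂

  InjectiveOnNeighbourhoods-⊆ : ∀ {K N : Subgroup Γ} → K ⊆S N →
    InjectiveOnNeighbourhoods N → InjectiveOnNeighbourhoods K
  InjectiveOnNeighbourhoods-⊆ {K} {N} K⊆N N-inj = record
    { neighbour-∉-orbit = λ u~w → neighbour-∉-orbit u~w ∘ Orb-⊆ {K} {N} K⊆N
    ; neighbours-≡      = λ u~w₁ u~w₂ → neighbours-≡ u~w₁ u~w₂ ∘ Orb-⊆ {K} {N} K⊆N
    }
    where open InjectiveOnNeighbourhoods N-inj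

  edge⇒QAdj : ∀ {H : Subgroup Γ} → InjectiveOnNeighbourhoods H →
              ∀ {u v w} → u ~ w → Orb H v w → QAdj H u v
  edge⇒QAdj {H} H-inj u~w v≈w =
    (λ u≈v → neighbour-∉-orbit u~w (Orb.trans H u≈v v≈w)) , _ , _ , Orb.refl H , v≈w , u~w
    where open InjectiveOnNeighbourhoods H-inj

  cover⇒injectiveOnNeighbourhoods : ∀ {H : Subgroup Γ} → IsCover Γ H →
                                    InjectiveOnNeighbourhoods H
  cover⇒injectiveOnNeighbourhoods {H} cover = record
    { neighbour-∉-orbit = λ {u} → neighbour-∉-orbit u
    ; neighbours-≡      = λ {u} → SelfMap.R⇒≡ u
    }
    where
    module _ (u : V) where
      open Bijection (cover u)

      image : ∀ v → u ~ v → V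
      image v u~v = proj₁ (to (v , u~v))

      lifted : ∀ v (u~v : u ~ v) → ∃ λ w → u ~ w × Orb H (image v u~v) w
      lifted v u~v = QAdj-lift {H} (proj₂ (to (v , u~v)))

      lifted-injective : ∀ {a b} p q → Orb H (proj₁ (lifted a p)) (proj₁ (lifted b q)) → a ≡ b
      lifted-injective p q r = injective
        (Orb.trans H (proj₂ (proj₂ (lifted _ p))) (Orb.trans H r (Orb.sym H (proj₂ (proj₂ (lifted _ q))))))

      module SelfMap = SelfMapOfFiniteSubset {R = Orb H} (Orb.refl H) (~-dec u)
        (λ v p → proj₁ (lifted v p)) (λ p → proj₁ (proj₂ (lifted _ p))) lifted-injective

      neighbour-∉-orbit : ∀ {w} → u ~ w → ¬ Orb H u w
      neighbour-∉-orbit u~w u≈w =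
        let a , p , lifted≡w = SelfMap.surjective u~w
            image≈lifted = proj₂ (proj₂ (lifted a p))
        in proj₁ (proj₂ (to (a , p)))
             (Orb.trans H u≈w (Orb.sym H (subst (Orb H (image a p)) lifted≡w image≈lifted)))

  injectiveOnNeighbourhoods⇒cover : ∀ {H : Subgroup Γ} → InjectiveOnNeighbourhoods H →
                                    IsCover Γ H
  injectiveOnNeighbourhoods⇒cover {H} H-inj u = record
    { to        = λ (w , u~w) → w , edge⇒QAdj H-inj u~w (Orb.refl H)
    ; cong      = Orb.reflexive H
    ; bijective = (λ {(_ , u~w₁)} {(_ , u~w₂)} → neighbours-≡ u~w₁ u~w₂)
                , λ (v , u~v) → let w , u~w , v≈w = QAdj-lift {H} u~v in
                    (w , u~w) , λ { refl → Orb.sym H v≈w }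
    }
    where open InjectiveOnNeighbourhoods H-inj

  injectiveOnNeighbourhoods⇒quotCover : ∀ {K N : Subgroup Γ} → K ⊆S N →
    InjectiveOnNeighbourhoods N → IsQuotCover Γ K N
  injectiveOnNeighbourhoods⇒quotCover {K} {N} K⊆N N-inj u = record
    { to        = λ (v , u~v) → let _ , u~w , v≈w = QAdj-lift {K} u~v in
                    v , edge⇒QAdj N-inj u~w (Orb-⊆ {K} {N} K⊆N v≈w)
    ; cong      = Orb-⊆ {K} {N} K⊆N
    ; bijective = (λ {x} {y} → injective {x} {y}) , surjective
    }
    where
    open InjectiveOnNeighbourhoods N-inj

    injective : ∀ {x y : Σ V (QAdj K u)} → Orb N (proj₁ x) (proj₁ y) → Orb K (proj₁ x) (proj₁ y)
    injective {v₁ , u~v₁} {v₂ , u~v₂} v₁≈v₂ =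
      let w₁ , u~w₁ , v₁≈w₁ = QAdj-lift {K} u~v₁
          w₂ , u~w₂ , v₂≈w₂ = QAdj-lift {K} u~v₂
          w₁≡w₂ = neighbours-≡ u~w₁ u~w₂
            (Orb.trans N (Orb.sym N (Orb-⊆ {K} {N} K⊆N v₁≈w₁)) (Orb.trans N v₁≈v₂ (Orb-⊆ {K} {N} K⊆N v₂≈w₂)))
      in Orb.trans K v₁≈w₁ (subst (λ t → Orb K t v₂) (sym w₁≡w₂) (Orb.sym K v₂≈w₂))

    surjective : ∀ (y : Σ V (QAdj N u)) → Σ (Σ V (QAdj K u)) λ x →
                 ∀ {z : Σ V (QAdj K u)} → Orb K (proj₁ z) (proj₁ x) → Orb N (proj₁ z) (proj₁ y)
    surjective (v , u~v) =
      let w , u~w , v≈w = QAdj-lift {N} u~v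
          K-inj = InjectiveOnNeighbourhoods-⊆ {K} {N} K⊆N N-inj
      in (w , edge⇒QAdj K-inj u~w (Orb.refl K)) ,
         λ z≈w → Orb.trans N (Orb-⊆ {K} {N} K⊆N z≈w) (Orb.sym N v≈w)

lemma3p3 : (Γ : Graph) (X N K : Subgroup Γ) →
    Connected Γ →
    DistTrans2 (toS Γ) (actX X) →
    IsNormal N X →
    IsCover Γ N →
    IsNormal K X →
    K ⊆S N →
    IsCover Γ K × IsQuotCover Γ K N ×
      DistTrans2 (Γ / K) (actX X) × DistTrans2 (Γ / N) (actX X)
lemma3p3 Γ X N K _ Γ-dt N⊴X N-cover K⊴X K⊆N =
  injectiveOnNeighbourhoods⇒cover (InjectiveOnNeighbourhoods-⊆ {K = K} {N} K⊆N N-inj) ,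
  injectiveOnNeighbourhoods⇒quotCover {K = K} {N} K⊆N N-inj ,
  /-distTrans2 K⊴X Γ-dt ,
  /-distTrans2 N⊴X Γ-dt
  where
  N-inj : InjectiveOnNeighbourhoods N
  N-inj = cover⇒injectiveOnNeighbourhoods N-cover
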